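{- Let $K$ be an imaginary quadratic number field with ring of integers $\mathcal{O}_K$. If $\{a,b,c\}\subseteq\mathcal{O}_K$ is a Diophantine triple and $abc\neq 0$, then none of $ab$, $ac$, $bc$ is a square in $K$.
   Context: A Diophantine triple in $\mathcal{O}_K$ is a set of three distinct elements of $\mathcal{O}_K$ such that the product of any two distinct elements plus one is a perfect square in $\mathcal{O}_K$. -}

module Defs where

open import Data.Nat using (ℕ)
open import Data.Nat.Divisibility using (_∣_)
open import Data.Integer as ℤ using (ℤ; ∣_∣; -[1+_])
open import Data.Rational as ℚ using (ℚ; ↧ₙ_; 0ℚ; 1ℚ)
open import Data.Product using (Σ; ∃; _×_; _,_)
open import Relation.Binary.PropositionalEquality using (_≡_; _≢_)

-- A squarefree negative integer d (d ≠ 0, d < 0, no square of n ≥ 2 divides d).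
-- Every imaginary quadratic field is ℚ(√d) for exactly one such d.
record ImagQuadParam : Set where
  constructor mkParam
  field
    d          : ℤ
    negative   : ∃ λ k → d ≡ -[1+ k ]
    squarefree : (n : ℕ) → (n Data.Nat.* n) ∣ ∣ d ∣ → n ≡ 1

-- Elements of K = ℚ(√d): the pair (p , q) stands for p + q√d.
K : Set
K = ℚ × ℚ

module Field (D : ImagQuadParam) where
  open ImagQuadParam D

  dℚ : ℚ
  dℚ = d ℚ./ 1

  infixl 7 _·_
  infixl 6 _⊕_

  _⊕_ : K → K → K
  (p₁ , q₁) ⊕ (p₂ , q₂) = (p₁ ℚ.+ p₂ , q₁ ℚ.+ q₂)

  _·_ : K → K → K
  (p₁ , q₁) · (p₂ , q₂) = (p₁ ℚ.* p₂ ℚ.+ dℚ ℚ.* (q₁ ℚ.* q₂) , p₁ ℚ.* q₂ ℚ.+ q₁ ℚ.* p₂)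

  0K : K
  0K = (0ℚ , 0ℚ)

  1K : K
  1K = (1ℚ , 0ℚ)

  tr : K → ℚ
  tr (p , q) = p ℚ.+ p

  nm : K → ℚ
  nm (p , q) = p ℚ.* p ℚ.- dℚ ℚ.* (q ℚ.* q)

  IsIntegerℚ : ℚ → Set
  IsIntegerℚ r = ↧ₙ r ≡ 1

  -- Membership in O_K: α is an algebraic integer, i.e. it is a root of its
  -- characteristic polynomial X² - tr(α) X + nm(α), which has integer coefficients.
  InOK : K → Set
  InOK α = IsIntegerℚ (tr α) × IsIntegerℚ (nm α)

  IsSquareK : K → Set
  IsSquareK x = Σ K λ z → x ≡ z · z

  IsSquareOK : K → Set
  IsSquareOK x = Σ K λ z → InOK z × x ≡ z · z

  IsDiophantineTriple : K → K → K → Set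
  IsDiophantineTriple a b c =
    InOK a × InOK b × InOK c ×
    a ≢ b × a ≢ c × b ≢ c ×
    IsSquareOK (a · b ⊕ 1K) × IsSquareOK (a · c ⊕ 1K) × IsSquareOK (b · c ⊕ 1K)

{-# OPTIONS --safe #-}
-- Suppose ab = z² and ab + 1 = w² with w integral. Then N z is an integer, as its square
-- N (w² - 1) is, and (w + z)(w - z) = 1, so N (w ± z) are the roots of t² - 2 (N w + N z) t + 1.
-- Being rational roots of a monic integer polynomial they are natural numbers, hence both 1;
-- so N w + N z = 1, and z ≠ 0 forces w = 0, i.e. ab = -1 = z². Then a has norm 1, b = -ā, and
-- tr(a)² = 4 + d (2 Im a)² ≤ 4 leaves three cases: tr a = 0 gives b = a; tr a = ±1 gives
-- d (2 Im a)² = -3, while z² = -1 gives d v² = -1, so 3 would be a rational square; and a = ±1,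
-- b = -a turns (ac + 1)(bc + 1) = 1 - c² into c² = (zxy)² + 1, so by the first step c = 0 or
-- c² = 1, i.e. c ∈ {a, b}.
module Submission where

open import Defs
open import Data.Empty using (⊥; ⊥-elim)
open import Data.Nat as ℕ using (ℕ; zero; suc)
import Data.Nat.Properties as ℕ
open import Data.Nat.Coprimality as Coprime using (Coprime; coprime-divisor)
open import Data.Nat.Divisibility using (_∣_; divides; ∣-refl)
open import Data.Integer as ℤ using (+_; -[1+_])
import Data.Integer.Properties as ℤ
open import Data.Rational as ℚ using (ℚ; mkℚ; 0ℚ; 1ℚ; ½; _+_; _*_; _-_; -_; _≤_; ↥_; ↧_; ↧ₙ_)
import Data.Rational.Properties as ℚ
open import Algebra.Properties.Group ℚ.+-0-group using (x∙y⁻¹≈ε⇒x≈y; inverseˡ-unique; ⁻¹-involutive)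
open import Data.Rational.Literals using (fromℤ)
import Data.Rational.Unnormalised as ℚᵘ
import Data.Rational.Unnormalised.Properties as ℚᵘ
open import Data.Rational.Solver using (module +-*-Solver)
open import Data.Product using (_×_; _,_; ∃-syntax; proj₁; proj₂)
open import Data.Sum as Sum using (_⊎_; inj₁; inj₂; [_,_]′; reduce)
open import Function using (_∘_)
open import Relation.Binary.PropositionalEquality
open import Relation.Nullary using (¬_; yes; no)

open +-*-Solver

fromℤ-+ : ∀ k l → fromℤ (k ℤ.+ l) ≡ fromℤ k + fromℤ l
fromℤ-+ k l = ℚ.toℚᵘ-injective (ℚᵘ.≃-trans (ℚᵘ.*≡* eq) (ℚᵘ.≃-sym (ℚ.toℚᵘ-homo-+ (fromℤ k) (fromℤ l))))
  where
  eq : (k ℤ.+ l) ℤ.* + 1 ≡ (k ℤ.* + 1 ℤ.+ l ℤ.* + 1) ℤ.* + 1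
  eq = cong (ℤ._* + 1) (sym (cong₂ ℤ._+_ (ℤ.*-identityʳ k) (ℤ.*-identityʳ l)))

fromℤ-* : ∀ k l → fromℤ (k ℤ.* l) ≡ fromℤ k * fromℤ l
fromℤ-* k l = ℚ.toℚᵘ-injective (ℚᵘ.≃-trans (ℚᵘ.*≡* refl) (ℚᵘ.≃-sym (ℚ.toℚᵘ-homo-* (fromℤ k) (fromℤ l))))

fromℤ-neg : ∀ k → fromℤ (ℤ.- k) ≡ - fromℤ k
fromℤ-neg (+ zero)  = refl
fromℤ-neg (+ suc n) = refl
fromℤ-neg -[1+ n ]  = refl

fromℤ-injective : ∀ {k l} → fromℤ k ≡ fromℤ l → k ≡ l
fromℤ-injective = cong ↥_

fromℤ-cancel-≤ : ∀ {k l} → fromℤ k ≤ fromℤ l → k ℤ.≤ l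
fromℤ-cancel-≤ {k} {l} (ℚ.*≤* le) = subst₂ ℤ._≤_ (ℤ.*-identityʳ k) (ℤ.*-identityʳ l) le

↧*≡↥ : ∀ x → fromℤ (↧ x) * x ≡ fromℤ (↥ x)
↧*≡↥ x@(mkℚ n m-1 _) = ℚ.toℚᵘ-injective (ℚᵘ.≃-trans (ℚ.toℚᵘ-homo-* (fromℤ (↧ x)) x) (ℚᵘ.*≡* eq))
  where
  eq : (+ suc m-1 ℤ.* n) ℤ.* + 1 ≡ n ℤ.* + (1 ℕ.* suc m-1)
  eq = trans (ℤ.*-identityʳ _)
    (trans (ℤ.*-comm (+ suc m-1) n) (cong (λ j → n ℤ.* + j) (sym (ℕ.*-identityˡ (suc m-1)))))

IsInt : ℚ → Set
IsInt x = ∃[ k ] x ≡ fromℤ k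

↧ₙ≡1⇒IsInt : ∀ x → ↧ₙ x ≡ 1 → IsInt x
↧ₙ≡1⇒IsInt (mkℚ n zero _) refl = n , refl

IsInt-+ : ∀ {x y} → IsInt x → IsInt y → IsInt (x + y)
IsInt-+ (k , refl) (l , refl) = k ℤ.+ l , sym (fromℤ-+ k l)

IsInt-* : ∀ {x y} → IsInt x → IsInt y → IsInt (x * y)
IsInt-* (k , refl) (l , refl) = k ℤ.* l , sym (fromℤ-* k l)

IsInt-neg : ∀ {x} → IsInt x → IsInt (- x)
IsInt-neg (k , refl) = ℤ.- k , sym (fromℤ-neg k)

-- x is a root of the monic integer polynomial t² - (x + y) t + x y, so clearing
-- denominators ↧ x divides (↥ x)², which forces ↧ x = 1 by coprimality.
IsInt-root : ∀ x y → IsInt (x + y) → IsInt (x * y) → IsInt x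
IsInt-root x@(mkℚ n _ c) y x+y-int xy-int = ↧ₙ≡1⇒IsInt x (coprime (↧∣n , ∣-refl))
  where
  m = ↧ x
  r = (x + y) * (fromℤ m * x) - fromℤ m * (x * y)

  r-int : IsInt r
  r-int = IsInt-+ (IsInt-* x+y-int (n , ↧*≡↥ x)) (IsInt-neg (IsInt-* (m , refl) xy-int))

  t = proj₁ r-int

  n²≡mt : n ℤ.* n ≡ m ℤ.* t
  n²≡mt = fromℤ-injective (begin
    fromℤ (n ℤ.* n)                ≡⟨ fromℤ-* n n ⟩
    fromℤ n * fromℤ n              ≡⟨ cong₂ _*_ (↧*≡↥ x) (↧*≡↥ x) ⟨
    (fromℤ m * x) * (fromℤ m * x)  ≡⟨ solve 3 (λ m x y → (m :* x) :* (m :* x)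
                                         := m :* ((x :+ y) :* (m :* x) :- m :* (x :* y))) refl (fromℤ m) x y ⟩
    fromℤ m * r                    ≡⟨ cong (fromℤ m *_) (proj₂ r-int) ⟩
    fromℤ m * fromℤ t              ≡⟨ fromℤ-* m t ⟨
    fromℤ (m ℤ.* t)                ∎)
    where open ≡-Reasoning

  coprime : Coprime ℤ.∣ n ∣ (↧ₙ x)
  coprime = Coprime.recompute c

  ↧∣n : ↧ₙ x ∣ ℤ.∣ n ∣
  ↧∣n = coprime-divisor (Coprime.sym coprime) (divides ℤ.∣ t ∣ (begin
    ℤ.∣ n ∣ ℕ.* ℤ.∣ n ∣   ≡⟨ ℤ.abs-* n n ⟨
    ℤ.∣ n ℤ.* n ∣         ≡⟨ cong ℤ.∣_∣ n²≡mt ⟩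
    ℤ.∣ m ℤ.* t ∣         ≡⟨ ℤ.abs-* m t ⟩
    ↧ₙ x ℕ.* ℤ.∣ t ∣      ≡⟨ ℕ.*-comm (↧ₙ x) ℤ.∣ t ∣ ⟩
    ℤ.∣ t ∣ ℕ.* ↧ₙ x      ∎))
    where open ≡-Reasoning

IsInt-sqrt : ∀ x → IsInt (x * x) → IsInt x
IsInt-sqrt x (k , x²≡k) = IsInt-root x (- x) (ℤ.0ℤ , ℚ.+-inverseʳ x) (ℤ.- k , x*-x≡-k)
  where
  x*-x≡-k : x * - x ≡ fromℤ (ℤ.- k)
  x*-x≡-k = trans (solve 1 (λ x → x :* (:- x) := :- (x :* x)) refl x)
                  (trans (cong -_ x²≡k) (sym (fromℤ-neg k)))

IsNat : ℚ → Set
IsNat x = ∃[ n ] x ≡ fromℤ (+ n)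

IsInt∧≥0⇒IsNat : ∀ {x} → IsInt x → 0ℚ ≤ x → IsNat x
IsInt∧≥0⇒IsNat (k , refl) 0≤k with fromℤ-cancel-≤ {+ 0} {k} 0≤k
... | ℤ.+≤+ _ = _ , refl

IsNat-unit : ∀ {x y} → IsNat x → IsNat y → x * y ≡ 1ℚ → x ≡ 1ℚ
IsNat-unit (m , refl) (n , refl) xy≡1 = cong (λ k → fromℤ (+ k)) (ℕ.m*n≡1⇒m≡1 m n mn≡1)
  where
  mn≡1 : m ℕ.* n ≡ 1
  mn≡1 = ℤ.+-injective (fromℤ-injective (trans (cong fromℤ (ℤ.pos-* m n)) (trans (fromℤ-* (+ m) (+ n)) xy≡1)))

IsNat-+≡1 : ∀ {x y} → IsNat x → IsNat y → y ≢ 0ℚ → x + y ≡ 1ℚ → x ≡ 0ℚ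
IsNat-+≡1 (m , refl) (zero , refl) y≢0 _ = ⊥-elim (y≢0 refl)
IsNat-+≡1 (m , refl) (suc n , refl) _ x+y≡1 = cong (λ k → fromℤ (+ k)) (ℕ.m+n≡0⇒m≡0 m m+n≡0)
  where
  m+n≡0 : m ℕ.+ n ≡ 0
  m+n≡0 = ℕ.suc-injective (trans (sym (ℕ.+-suc m n)) (ℤ.+-injective (fromℤ-injective
            (trans (cong fromℤ (ℤ.pos-+ m (suc n))) (trans (fromℤ-+ (+ m) (+ suc n)) x+y≡1)))))

p*p≥0 : ∀ p → 0ℚ ≤ p * p
p*p≥0 p with ℚ.≤-total 0ℚ p
... | inj₁ 0≤p = ℚ.nonNegative⁻¹ _ {{ℚ.nonNeg*nonNeg⇒nonNeg p {{ℚ.nonNegative 0≤p}} p {{ℚ.nonNegative 0≤p}}}}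
... | inj₂ p≤0 = ℚ.nonNegative⁻¹ _ {{ℚ.nonPos*nonPos⇒nonPos p {{ℚ.nonPositive p≤0}} p {{ℚ.nonPositive p≤0}}}}

p*q≡0⇒p≡0∨q≡0 : ∀ p q → p * q ≡ 0ℚ → p ≡ 0ℚ ⊎ q ≡ 0ℚ
p*q≡0⇒p≡0∨q≡0 p q pq≡0 with p ℚ.≟ 0ℚ
... | yes p≡0 = inj₁ p≡0
... | no p≢0 = inj₂ (begin
  q                 ≡⟨ ℚ.*-identityˡ q ⟨
  1ℚ * q            ≡⟨ cong (_* q) (ℚ.*-inverseˡ p) ⟨
  (ℚ.1/ p * p) * q  ≡⟨ ℚ.*-assoc (ℚ.1/ p) p q ⟩
  ℚ.1/ p * (p * q)  ≡⟨ cong (ℚ.1/ p *_) pq≡0 ⟩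
  ℚ.1/ p * 0ℚ       ≡⟨ ℚ.*-zeroʳ (ℚ.1/ p) ⟩
  0ℚ                ∎)
  where
  open ≡-Reasoning
  instance _ = ℚ.≢-nonZero p≢0

p*p≡0⇒p≡0 : ∀ p → p * p ≡ 0ℚ → p ≡ 0ℚ
p*p≡0⇒p≡0 p = reduce ∘ p*q≡0⇒p≡0∨q≡0 p p

0≤p→0≤q→p+q≡0⇒p≡0 : ∀ {p q} → 0ℚ ≤ p → 0ℚ ≤ q → p + q ≡ 0ℚ → p ≡ 0ℚ
0≤p→0≤q→p+q≡0⇒p≡0 {p} {q} 0≤p 0≤q p+q≡0 = ℚ.≤-antisym (begin
  p       ≡⟨ ℚ.+-identityʳ p ⟨
  p + 0ℚ  ≤⟨ ℚ.+-monoʳ-≤ p 0≤q ⟩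
  p + q   ≡⟨ p+q≡0 ⟩
  0ℚ      ∎) 0≤p
  where open ℚ.≤-Reasoning

p+p≡q+q⇒p≡q : ∀ {p q} → p + p ≡ q + q → p ≡ q
p+p≡q+q⇒p≡q {p} {q} 2p≡2q = begin
  p             ≡⟨ solve 1 (λ p → p := (p :+ p) :* con ½) refl p ⟩
  (p + p) * ½   ≡⟨ cong (_* ½) 2p≡2q ⟩
  (q + q) * ½   ≡⟨ solve 1 (λ q → (q :+ q) :* con ½ := q) refl q ⟩
  q             ∎
  where open ≡-Reasoning

p+p≡0⇒p≡0 : ∀ {p} → p + p ≡ 0ℚ → p ≡ 0ℚ
p+p≡0⇒p≡0 = p+p≡q+q⇒p≡q

[3+n]²≰4 : ∀ n → ¬ (3 ℕ.+ n) ℕ.* (3 ℕ.+ n) ℕ.≤ 4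
[3+n]²≰4 n [3+n]²≤4 with ℕ.≤-trans (ℕ.*-mono-≤ (ℕ.m≤m+n 3 n) (ℕ.m≤m+n 3 n)) [3+n]²≤4
... | ℕ.s≤s (ℕ.s≤s (ℕ.s≤s (ℕ.s≤s ())))

fromℤ-square-cancel-≤ : ∀ k l → fromℤ k * fromℤ k ≤ fromℤ l → k ℤ.* k ℤ.≤ l
fromℤ-square-cancel-≤ k l = fromℤ-cancel-≤ ∘ subst (_≤ fromℤ l) (sym (fromℤ-* k k))

IsInt-square≤4 : ∀ {t} → IsInt t → t * t ≤ fromℤ (+ 4) → t ≡ 0ℚ ⊎ t * t ≡ 1ℚ ⊎ t * t ≡ fromℤ (+ 4)
IsInt-square≤4 (+ 0 , refl)      _ = inj₁ refl
IsInt-square≤4 (+ 1 , refl)      _ = inj₂ (inj₁ refl)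
IsInt-square≤4 (+ 2 , refl)      _ = inj₂ (inj₂ refl)
IsInt-square≤4 (-[1+ 0 ] , refl) _ = inj₂ (inj₁ refl)
IsInt-square≤4 (-[1+ 1 ] , refl) _ = inj₂ (inj₂ refl)
IsInt-square≤4 (+ suc (suc (suc n)) , refl) t²≤4 = ⊥-elim ([3+n]²≰4 n (ℤ.drop‿+≤+
  (subst (ℤ._≤ + 4) (sym (ℤ.pos-* (3 ℕ.+ n) (3 ℕ.+ n))) (fromℤ-square-cancel-≤ (+ (3 ℕ.+ n)) (+ 4) t²≤4))))
IsInt-square≤4 (-[1+ suc (suc n) ] , refl) t²≤4 =
  ⊥-elim ([3+n]²≰4 n (ℤ.drop‿+≤+ (fromℤ-square-cancel-≤ -[1+ suc (suc n) ] (+ 4) t²≤4)))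

n*n≢3 : ∀ n → n ℕ.* n ≢ 3
n*n≢3 0 ()
n*n≢3 1 ()
n*n≢3 (suc (suc n)) n²≡3 with subst (4 ℕ.≤_) n²≡3 (ℕ.*-mono-≤ {2} {suc (suc n)} 2≤n+2 2≤n+2)
  where 2≤n+2 = ℕ.s≤s (ℕ.s≤s ℕ.z≤n)
... | ℕ.s≤s (ℕ.s≤s (ℕ.s≤s ()))

p*p≢3 : ∀ p → p * p ≢ fromℤ (+ 3)
p*p≢3 p p²≡3 with IsInt-sqrt p (+ 3 , p²≡3)
... | k , refl = n*n≢3 ℤ.∣ k ∣ (begin
  ℤ.∣ k ∣ ℕ.* ℤ.∣ k ∣  ≡⟨ ℤ.abs-* k k ⟨
  ℤ.∣ k ℤ.* k ∣        ≡⟨ cong ℤ.∣_∣ (fromℤ-injective (trans (fromℤ-* k k) p²≡3)) ⟩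
  3                    ∎)
  where open ≡-Reasoning

-1∈dℚ²⇒-3∉dℚ² : ∀ d u v → d * (v * v) ≡ - 1ℚ → d * (u * u) ≢ - fromℤ (+ 3)
-1∈dℚ²⇒-3∉dℚ² d u v dv²≡-1 du²≡-3 = p*p≢3 (u * v⁻¹) (begin
  (u * v⁻¹) * (u * v⁻¹)
    ≡⟨ solve 2 (λ u v⁻¹ → (u :* v⁻¹) :* (u :* v⁻¹) := :- (con (- 1ℚ) :* (u :* u)) :* (v⁻¹ :* v⁻¹)) refl u v⁻¹ ⟩
  - (- 1ℚ * (u * u)) * (v⁻¹ * v⁻¹)
    ≡⟨ cong (λ m → - (m * (u * u)) * (v⁻¹ * v⁻¹)) dv²≡-1 ⟨
  - (d * (v * v) * (u * u)) * (v⁻¹ * v⁻¹)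
    ≡⟨ solve 4 (λ d u v v⁻¹ → :- (d :* (v :* v) :* (u :* u)) :* (v⁻¹ :* v⁻¹)
                            := :- (d :* (u :* u)) :* ((v :* v⁻¹) :* (v :* v⁻¹))) refl d u v v⁻¹ ⟩
  - (d * (u * u)) * ((v * v⁻¹) * (v * v⁻¹))
    ≡⟨ cong₂ (λ m w → - m * (w * w)) du²≡-3 (ℚ.*-inverseʳ v) ⟩
  fromℤ (+ 3) ∎)
  where
  open ≡-Reasoning
  v≢0 : v ≢ 0ℚ
  v≢0 v≡0 with () ← cong ↥_ (trans (sym (ℚ.*-zeroʳ d)) (subst (λ v → d * (v * v) ≡ - 1ℚ) v≡0 dv²≡-1))
  instance _ = ℚ.≢-nonZero v≢0
  v⁻¹ = ℚ.1/ v

-- The operations of Field on solver polynomials, with d itself a variable,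
-- so that identities in K are checked coordinatewise by the ring solver.
module Symbolic {n : ℕ} (d : Polynomial n) where
  infixl 7 _·ₚ_
  infixl 6 _⊕ₚ_

  Kₚ : Set
  Kₚ = Polynomial n × Polynomial n

  _⊕ₚ_ : Kₚ → Kₚ → Kₚ
  (p₁ , q₁) ⊕ₚ (p₂ , q₂) = (p₁ :+ p₂ , q₁ :+ q₂)

  _·ₚ_ : Kₚ → Kₚ → Kₚ
  (p₁ , q₁) ·ₚ (p₂ , q₂) = (p₁ :* p₂ :+ d :* (q₁ :* q₂) , p₁ :* q₂ :+ q₁ :* p₂)

  -ₚ_ : Kₚ → Kₚ
  -ₚ (p , q) = (:- p , :- q)

  conjₚ : Kₚ → Kₚ
  conjₚ (p , q) = (p , :- q)

  0ₚ 1ₚ : Kₚ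
  0ₚ = (con 0ℚ , con 0ℚ)
  1ₚ = (con 1ℚ , con 0ℚ)

  trₚ nmₚ : Kₚ → Polynomial n
  trₚ (p , q) = p :+ p
  nmₚ (p , q) = p :* p :- d :* (q :* q)

module ImaginaryQuadratic (D : ImagQuadParam) where
  open ImagQuadParam D
  open Field D

  infix 8 -K_

  -K_ : K → K
  -K (p , q) = (- p , - q)

  conj : K → K
  conj (p , q) = (p , - q)

  ·-comm : ∀ x y → x · y ≡ y · x
  ·-comm (x₁ , x₂) (y₁ , y₂) = cong₂ _,_
    (solve 5 (λ δ x₁ x₂ y₁ y₂ → let open Symbolic δ in
      proj₁ ((x₁ , x₂) ·ₚ (y₁ , y₂)) := proj₁ ((y₁ , y₂) ·ₚ (x₁ , x₂))) refl dℚ x₁ x₂ y₁ y₂)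
    (solve 5 (λ δ x₁ x₂ y₁ y₂ → let open Symbolic δ in
      proj₂ ((x₁ , x₂) ·ₚ (y₁ , y₂)) := proj₂ ((y₁ , y₂) ·ₚ (x₁ , x₂))) refl dℚ x₁ x₂ y₁ y₂)

  ·-assoc : ∀ x y z → (x · y) · z ≡ x · (y · z)
  ·-assoc (x₁ , x₂) (y₁ , y₂) (z₁ , z₂) = cong₂ _,_
    (solve 7 (λ δ x₁ x₂ y₁ y₂ z₁ z₂ → let open Symbolic δ in
      proj₁ (((x₁ , x₂) ·ₚ (y₁ , y₂)) ·ₚ (z₁ , z₂)) := proj₁ ((x₁ , x₂) ·ₚ ((y₁ , y₂) ·ₚ (z₁ , z₂))))
      refl dℚ x₁ x₂ y₁ y₂ z₁ z₂)
    (solve 7 (λ δ x₁ x₂ y₁ y₂ z₁ z₂ → let open Symbolic δ in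
      proj₂ (((x₁ , x₂) ·ₚ (y₁ , y₂)) ·ₚ (z₁ , z₂)) := proj₂ ((x₁ , x₂) ·ₚ ((y₁ , y₂) ·ₚ (z₁ , z₂))))
      refl dℚ x₁ x₂ y₁ y₂ z₁ z₂)

  ·-identityˡ : ∀ x → 1K · x ≡ x
  ·-identityˡ (x₁ , x₂) = cong₂ _,_
    (solve 3 (λ δ x₁ x₂ → let open Symbolic δ in proj₁ (1ₚ ·ₚ (x₁ , x₂)) := x₁) refl dℚ x₁ x₂)
    (solve 3 (λ δ x₁ x₂ → let open Symbolic δ in proj₂ (1ₚ ·ₚ (x₁ , x₂)) := x₂) refl dℚ x₁ x₂)

  ·-zeroʳ : ∀ x → x · 0K ≡ 0K
  ·-zeroʳ (x₁ , x₂) = cong₂ _,_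
    (solve 3 (λ δ x₁ x₂ → let open Symbolic δ in proj₁ ((x₁ , x₂) ·ₚ 0ₚ) := con 0ℚ) refl dℚ x₁ x₂)
    (solve 3 (λ δ x₁ x₂ → let open Symbolic δ in proj₂ ((x₁ , x₂) ·ₚ 0ₚ) := con 0ℚ) refl dℚ x₁ x₂)

  ·-zeroˡ : ∀ x → 0K · x ≡ 0K
  ·-zeroˡ x = trans (·-comm 0K x) (·-zeroʳ x)

  x·-1≡-x : ∀ x → x · -K 1K ≡ -K x
  x·-1≡-x (x₁ , x₂) = cong₂ _,_
    (solve 3 (λ δ x₁ x₂ → let open Symbolic δ in proj₁ ((x₁ , x₂) ·ₚ -ₚ 1ₚ) := :- x₁) refl dℚ x₁ x₂)
    (solve 3 (λ δ x₁ x₂ → let open Symbolic δ in proj₂ ((x₁ , x₂) ·ₚ -ₚ 1ₚ) := :- x₂) refl dℚ x₁ x₂)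

  ·-conj : ∀ x → x · conj x ≡ (nm x , 0ℚ)
  ·-conj (x₁ , x₂) = cong₂ _,_
    (solve 3 (λ δ x₁ x₂ → let open Symbolic δ in
      proj₁ ((x₁ , x₂) ·ₚ conjₚ (x₁ , x₂)) := nmₚ (x₁ , x₂)) refl dℚ x₁ x₂)
    (solve 3 (λ δ x₁ x₂ → let open Symbolic δ in
      proj₂ ((x₁ , x₂) ·ₚ conjₚ (x₁ , x₂)) := con 0ℚ) refl dℚ x₁ x₂)

  [x⊕y]·[x⊖y]≡x²⊖y² : ∀ x y → (x ⊕ y) · (x ⊕ -K y) ≡ x · x ⊕ -K (y · y)
  [x⊕y]·[x⊖y]≡x²⊖y² (x₁ , x₂) (y₁ , y₂) = cong₂ _,_
    (solve 5 (λ δ x₁ x₂ y₁ y₂ → let open Symbolic δ in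
      proj₁ (((x₁ , x₂) ⊕ₚ (y₁ , y₂)) ·ₚ ((x₁ , x₂) ⊕ₚ -ₚ (y₁ , y₂)))
        := proj₁ ((x₁ , x₂) ·ₚ (x₁ , x₂) ⊕ₚ -ₚ ((y₁ , y₂) ·ₚ (y₁ , y₂)))) refl dℚ x₁ x₂ y₁ y₂)
    (solve 5 (λ δ x₁ x₂ y₁ y₂ → let open Symbolic δ in
      proj₂ (((x₁ , x₂) ⊕ₚ (y₁ , y₂)) ·ₚ ((x₁ , x₂) ⊕ₚ -ₚ (y₁ , y₂)))
        := proj₂ ((x₁ , x₂) ·ₚ (x₁ , x₂) ⊕ₚ -ₚ ((y₁ , y₂) ·ₚ (y₁ , y₂)))) refl dℚ x₁ x₂ y₁ y₂)

  [x·y]²≡x²·y² : ∀ x y → (x · y) · (x · y) ≡ (x · x) · (y · y)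
  [x·y]²≡x²·y² (x₁ , x₂) (y₁ , y₂) = cong₂ _,_
    (solve 5 (λ δ x₁ x₂ y₁ y₂ → let open Symbolic δ in
      proj₁ (((x₁ , x₂) ·ₚ (y₁ , y₂)) ·ₚ ((x₁ , x₂) ·ₚ (y₁ , y₂)))
        := proj₁ (((x₁ , x₂) ·ₚ (x₁ , x₂)) ·ₚ ((y₁ , y₂) ·ₚ (y₁ , y₂)))) refl dℚ x₁ x₂ y₁ y₂)
    (solve 5 (λ δ x₁ x₂ y₁ y₂ → let open Symbolic δ in
      proj₂ (((x₁ , x₂) ·ₚ (y₁ , y₂)) ·ₚ ((x₁ , x₂) ·ₚ (y₁ , y₂)))
        := proj₂ (((x₁ , x₂) ·ₚ (x₁ , x₂)) ·ₚ ((y₁ , y₂) ·ₚ (y₁ , y₂)))) refl dℚ x₁ x₂ y₁ y₂)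

  -[ac+1][-ac+1]+1≡a²c² : ∀ a c → -K 1K · ((a · c ⊕ 1K) · (-K a · c ⊕ 1K)) ⊕ 1K ≡ (a · a) · (c · c)
  -[ac+1][-ac+1]+1≡a²c² (a₁ , a₂) (c₁ , c₂) = cong₂ _,_
    (solve 5 (λ δ a₁ a₂ c₁ c₂ → let open Symbolic δ in
      proj₁ (-ₚ 1ₚ ·ₚ (((a₁ , a₂) ·ₚ (c₁ , c₂) ⊕ₚ 1ₚ) ·ₚ (-ₚ (a₁ , a₂) ·ₚ (c₁ , c₂) ⊕ₚ 1ₚ)) ⊕ₚ 1ₚ)
        := proj₁ (((a₁ , a₂) ·ₚ (a₁ , a₂)) ·ₚ ((c₁ , c₂) ·ₚ (c₁ , c₂)))) refl dℚ a₁ a₂ c₁ c₂)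
    (solve 5 (λ δ a₁ a₂ c₁ c₂ → let open Symbolic δ in
      proj₂ (-ₚ 1ₚ ·ₚ (((a₁ , a₂) ·ₚ (c₁ , c₂) ⊕ₚ 1ₚ) ·ₚ (-ₚ (a₁ , a₂) ·ₚ (c₁ , c₂) ⊕ₚ 1ₚ)) ⊕ₚ 1ₚ)
        := proj₂ (((a₁ , a₂) ·ₚ (a₁ , a₂)) ·ₚ ((c₁ , c₂) ·ₚ (c₁ , c₂)))) refl dℚ a₁ a₂ c₁ c₂)

  ⊕-comm : ∀ x y → x ⊕ y ≡ y ⊕ x
  ⊕-comm (x₁ , x₂) (y₁ , y₂) = cong₂ _,_ (ℚ.+-comm x₁ y₁) (ℚ.+-comm x₂ y₂)

  [x⊕y]⊖y≡x : ∀ x y → (x ⊕ y) ⊕ -K y ≡ x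
  [x⊕y]⊖y≡x (x₁ , x₂) (y₁ , y₂) = cong₂ _,_
    (solve 2 (λ x y → (x :+ y) :- y := x) refl x₁ y₁)
    (solve 2 (λ x y → (x :+ y) :- y := x) refl x₂ y₂)

  x⊖y≡0⇒x≡y : ∀ {x y} → x ⊕ -K y ≡ 0K → x ≡ y
  x⊖y≡0⇒x≡y {x₁ , x₂} {y₁ , y₂} eq =
    cong₂ _,_ (x∙y⁻¹≈ε⇒x≈y x₁ y₁ (cong proj₁ eq)) (x∙y⁻¹≈ε⇒x≈y x₂ y₂ (cong proj₂ eq))

  x⊕y≡0⇒x≡-y : ∀ {x y} → x ⊕ y ≡ 0K → x ≡ -K y
  x⊕y≡0⇒x≡-y {x₁ , x₂} {y₁ , y₂} eq =
    cong₂ _,_ (inverseˡ-unique x₁ y₁ (cong proj₁ eq)) (inverseˡ-unique x₂ y₂ (cong proj₂ eq))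

  x⊖x≡0 : ∀ x → x ⊕ -K x ≡ 0K
  x⊖x≡0 (x₁ , x₂) = cong₂ _,_ (ℚ.+-inverseʳ x₁) (ℚ.+-inverseʳ x₂)

  nm-· : ∀ x y → nm (x · y) ≡ nm x * nm y
  nm-· (x₁ , x₂) (y₁ , y₂) = solve 5 (λ δ x₁ x₂ y₁ y₂ → let open Symbolic δ in
    nmₚ ((x₁ , x₂) ·ₚ (y₁ , y₂)) := nmₚ (x₁ , x₂) :* nmₚ (y₁ , y₂)) refl dℚ x₁ x₂ y₁ y₂

  nm-0K : nm 0K ≡ 0ℚ
  nm-0K = solve 1 (λ δ → let open Symbolic δ in nmₚ 0ₚ := con 0ℚ) refl dℚ

  nm-1K : nm 1K ≡ 1ℚ
  nm-1K = solve 1 (λ δ → let open Symbolic δ in nmₚ 1ₚ := con 1ℚ) refl dℚ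

  nm-[-1K] : nm (-K 1K) ≡ 1ℚ
  nm-[-1K] = solve 1 (λ δ → let open Symbolic δ in nmₚ (-ₚ 1ₚ) := con 1ℚ) refl dℚ

  nm-[x²-1] : ∀ x → nm (x · x ⊕ -K 1K) ≡ (nm x + 1ℚ) * (nm x + 1ℚ) - tr x * tr x
  nm-[x²-1] (x₁ , x₂) = solve 3 (λ δ x₁ x₂ → let open Symbolic δ in
    nmₚ ((x₁ , x₂) ·ₚ (x₁ , x₂) ⊕ₚ -ₚ 1ₚ)
      := (nmₚ (x₁ , x₂) :+ con 1ℚ) :* (nmₚ (x₁ , x₂) :+ con 1ℚ) :- trₚ (x₁ , x₂) :* trₚ (x₁ , x₂))
    refl dℚ x₁ x₂

  nm-parallelogram : ∀ x y → nm (x ⊕ y) + nm (x ⊕ -K y) ≡ (nm x + nm y) + (nm x + nm y)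
  nm-parallelogram (x₁ , x₂) (y₁ , y₂) = solve 5 (λ δ x₁ x₂ y₁ y₂ → let open Symbolic δ in
    nmₚ ((x₁ , x₂) ⊕ₚ (y₁ , y₂)) :+ nmₚ ((x₁ , x₂) ⊕ₚ -ₚ (y₁ , y₂))
      := (nmₚ (x₁ , x₂) :+ nmₚ (y₁ , y₂)) :+ (nmₚ (x₁ , x₂) :+ nmₚ (y₁ , y₂)))
    refl dℚ x₁ x₂ y₁ y₂

  tr²≡4nm+disc : ∀ p q → tr (p , q) * tr (p , q) ≡ fromℤ (+ 4) * nm (p , q) + dℚ * ((q + q) * (q + q))
  tr²≡4nm+disc p q = solve 3 (λ δ p q → let open Symbolic δ in
    trₚ (p , q) :* trₚ (p , q) := con (fromℤ (+ 4)) :* nmₚ (p , q) :+ δ :* ((q :+ q) :* (q :+ q)))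
    refl dℚ p q

  dℚ-negative : ∃[ k ] dℚ ≡ - fromℤ (+ suc k)
  dℚ-negative with negative
  ... | k , d≡-[1+k] = k , trans (cong (ℚ._/ 1) d≡-[1+k])
                                 (cong -_ (ℚ.normalize-coprime (Coprime.sym (Coprime.1-coprimeTo (suc k)))))

  dℚ≢0 : dℚ ≢ 0ℚ
  dℚ≢0 d≡0 with () ← cong ℚ.↥_ (trans (sym (proj₂ dℚ-negative)) d≡0)

  0≤-dℚ : 0ℚ ≤ - dℚ
  0≤-dℚ = let k , d≡-[1+k] = dℚ-negative in subst (0ℚ ≤_)
    (sym (trans (cong -_ d≡-[1+k]) (⁻¹-involutive (fromℤ (+ suc k))))) (ℚ.*≤* (ℤ.+≤+ ℕ.z≤n))

  0≤[-d]q² : ∀ q → 0ℚ ≤ - dℚ * (q * q)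
  0≤[-d]q² q = ℚ.nonNegative⁻¹ _
    {{ℚ.nonNeg*nonNeg⇒nonNeg (- dℚ) {{ℚ.nonNegative 0≤-dℚ}} (q * q) {{ℚ.nonNegative (p*p≥0 q)}}}}

  dq²≡-[-d]q² : ∀ q → dℚ * (q * q) ≡ - (- dℚ * (q * q))
  dq²≡-[-d]q² q = solve 2 (λ δ q → δ :* (q :* q) := :- (:- δ :* (q :* q))) refl dℚ q

  dq²≤0 : ∀ q → dℚ * (q * q) ≤ 0ℚ
  dq²≤0 q = subst (_≤ 0ℚ) (sym (dq²≡-[-d]q² q)) (ℚ.neg-antimono-≤ (0≤[-d]q² q))

  dq²≡0⇒q≡0 : ∀ q → dℚ * (q * q) ≡ 0ℚ → q ≡ 0ℚ
  dq²≡0⇒q≡0 q dq²≡0 = [ ⊥-elim ∘ dℚ≢0 , p*p≡0⇒p≡0 q ]′ (p*q≡0⇒p≡0∨q≡0 dℚ (q * q) dq²≡0)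

  nm≡p²+[-d]q² : ∀ p q → nm (p , q) ≡ p * p + - dℚ * (q * q)
  nm≡p²+[-d]q² p q = solve 3 (λ δ p q → let open Symbolic δ in
    nmₚ (p , q) := p :* p :+ :- δ :* (q :* q)) refl dℚ p q

  nm-nonneg : ∀ x → 0ℚ ≤ nm x
  nm-nonneg (p , q) = subst (0ℚ ≤_) (sym (nm≡p²+[-d]q² p q)) (ℚ.+-mono-≤ (p*p≥0 p) (0≤[-d]q² q))

  nm≡0⇒x≡0 : ∀ x → nm x ≡ 0ℚ → x ≡ 0K
  nm≡0⇒x≡0 (p , q) nm≡0 = cong₂ _,_
    (p*p≡0⇒p≡0 p (0≤p→0≤q→p+q≡0⇒p≡0 (p*p≥0 p) (0≤[-d]q² q) sum≡0))
    (dq²≡0⇒q≡0 q (trans (dq²≡-[-d]q² q) (cong -_ [-d]q²≡0)))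
    where
    sum≡0 : p * p + - dℚ * (q * q) ≡ 0ℚ
    sum≡0 = trans (sym (nm≡p²+[-d]q² p q)) nm≡0
    [-d]q²≡0 : - dℚ * (q * q) ≡ 0ℚ
    [-d]q²≡0 = 0≤p→0≤q→p+q≡0⇒p≡0 (0≤[-d]q² q) (p*p≥0 p) (trans (ℚ.+-comm _ (p * p)) sum≡0)

  ·-zero-divisor : ∀ x y → x · y ≡ 0K → x ≡ 0K ⊎ y ≡ 0K
  ·-zero-divisor x y xy≡0 = Sum.map (nm≡0⇒x≡0 x) (nm≡0⇒x≡0 y)
    (p*q≡0⇒p≡0∨q≡0 (nm x) (nm y) (trans (sym (nm-· x y)) (trans (cong nm xy≡0) nm-0K)))

  x²≡y²⇒x≡±y : ∀ x y → x · x ≡ y · y → x ≡ y ⊎ x ≡ -K y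
  x²≡y²⇒x≡±y x y x²≡y² = Sum.swap (Sum.map x⊕y≡0⇒x≡-y x⊖y≡0⇒x≡y
    (·-zero-divisor (x ⊕ y) (x ⊕ -K y) (begin
      (x ⊕ y) · (x ⊕ -K y)  ≡⟨ [x⊕y]·[x⊖y]≡x²⊖y² x y ⟩
      x · x ⊕ -K (y · y)    ≡⟨ cong (_⊕ -K (y · y)) x²≡y² ⟩
      y · y ⊕ -K (y · y)    ≡⟨ x⊖x≡0 (y · y) ⟩
      0K                    ∎)))
    where open ≡-Reasoning

  tr-IsInt : ∀ x → InOK x → IsInt (tr x)
  tr-IsInt x (tr-int , _) = ↧ₙ≡1⇒IsInt (tr x) tr-int

  nm-IsNat : ∀ x → InOK x → IsNat (nm x)
  nm-IsNat x (_ , nm-int) = IsInt∧≥0⇒IsNat (↧ₙ≡1⇒IsInt (nm x) nm-int) (nm-nonneg x)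

  w²≡z²+1⇒w≡0 : ∀ {w z} → InOK w → w · w ≡ z · z ⊕ 1K → z ≢ 0K → w ≡ 0K
  w²≡z²+1⇒w≡0 {w} {z} w-int w²≡z²+1 z≢0 = nm≡0⇒x≡0 w (IsNat-+≡1 (nm-IsNat w w-int) n-nat n≢0 m+n≡1)
    where
    open ≡-Reasoning
    m = nm w
    n = nm z
    X = nm (w ⊕ z)
    Y = nm (w ⊕ -K z)

    m-int : IsInt m
    m-int = ↧ₙ≡1⇒IsInt m (proj₂ w-int)

    n²≡[m+1]²-r² : n * n ≡ (m + 1ℚ) * (m + 1ℚ) - tr w * tr w
    n²≡[m+1]²-r² = begin
      n * n                    ≡⟨ nm-· z z ⟨
      nm (z · z)               ≡⟨ cong nm ([x⊕y]⊖y≡x (z · z) 1K) ⟨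
      nm (z · z ⊕ 1K ⊕ -K 1K)  ≡⟨ cong (λ u → nm (u ⊕ -K 1K)) w²≡z²+1 ⟨
      nm (w · w ⊕ -K 1K)       ≡⟨ nm-[x²-1] w ⟩
      (m + 1ℚ) * (m + 1ℚ) - tr w * tr w ∎

    n-int : IsInt n
    n-int = IsInt-sqrt n (subst IsInt (sym n²≡[m+1]²-r²)
      (IsInt-+ (IsInt-* m+1-int m+1-int) (IsInt-neg (IsInt-* (tr-IsInt w w-int) (tr-IsInt w w-int)))))
      where m+1-int = IsInt-+ m-int (+ 1 , refl)

    n-nat : IsNat n
    n-nat = IsInt∧≥0⇒IsNat n-int (nm-nonneg z)

    n≢0 : n ≢ 0ℚ
    n≢0 = z≢0 ∘ nm≡0⇒x≡0 z

    XY≡1 : X * Y ≡ 1ℚ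
    XY≡1 = begin
      X * Y                         ≡⟨ nm-· (w ⊕ z) (w ⊕ -K z) ⟨
      nm ((w ⊕ z) · (w ⊕ -K z))     ≡⟨ cong nm ([x⊕y]·[x⊖y]≡x²⊖y² w z) ⟩
      nm (w · w ⊕ -K (z · z))       ≡⟨ cong (λ u → nm (u ⊕ -K (z · z))) w²≡z²+1 ⟩
      nm (z · z ⊕ 1K ⊕ -K (z · z))  ≡⟨ cong (λ u → nm (u ⊕ -K (z · z))) (⊕-comm (z · z) 1K) ⟩
      nm (1K ⊕ z · z ⊕ -K (z · z))  ≡⟨ cong nm ([x⊕y]⊖y≡x 1K (z · z)) ⟩
      nm 1K                         ≡⟨ nm-1K ⟩
      1ℚ                            ∎

    X+Y≡2[m+n] : X + Y ≡ (m + n) + (m + n)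
    X+Y≡2[m+n] = nm-parallelogram w z

    X+Y-int : IsInt (X + Y)
    X+Y-int = subst IsInt (sym X+Y≡2[m+n]) (IsInt-+ m+n-int m+n-int)
      where m+n-int = IsInt-+ m-int n-int

    m+n≡1 : m + n ≡ 1ℚ
    m+n≡1 = p+p≡q+q⇒p≡q (trans (sym X+Y≡2[m+n]) (cong₂ _+_ X≡1 Y≡1))
      where
      XY-int : IsInt (X * Y)
      XY-int = + 1 , XY≡1
      X-nat = IsInt∧≥0⇒IsNat (IsInt-root X Y X+Y-int XY-int) (nm-nonneg (w ⊕ z))
      Y-nat = IsInt∧≥0⇒IsNat
        (IsInt-root Y X (subst IsInt (ℚ.+-comm X Y) X+Y-int) (subst IsInt (ℚ.*-comm X Y) XY-int))
        (nm-nonneg (w ⊕ -K z))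
      X≡1 = IsNat-unit X-nat Y-nat XY≡1
      Y≡1 = IsNat-unit Y-nat X-nat (trans (ℚ.*-comm Y X) XY≡1)

  square∧square+1⇒≡-1 : ∀ {u} → IsSquareK u → IsSquareOK (u ⊕ 1K) → u ≢ 0K → u ≡ -K 1K
  square∧square+1⇒≡-1 {u} (z , u≡z²) (w , w-int , u+1≡w²) u≢0 = x⊕y≡0⇒x≡-y (begin
    u ⊕ 1K   ≡⟨ u+1≡w² ⟩
    w · w    ≡⟨ cong (λ v → v · v) w≡0 ⟩
    0K · 0K  ≡⟨ ·-zeroʳ 0K ⟩
    0K       ∎)
    where
    open ≡-Reasoning
    w≡0 : w ≡ 0K
    w≡0 = w²≡z²+1⇒w≡0 {w} {z} w-int (trans (sym u+1≡w²) (cong (_⊕ 1K) u≡z²))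
      (λ z≡0 → u≢0 (trans u≡z² (trans (cong (λ v → v · v) z≡0) (·-zeroʳ 0K))))

  nm-unit : ∀ {a b} → InOK a → InOK b → a · b ≡ -K 1K → nm a ≡ 1ℚ
  nm-unit {a} {b} a-int b-int ab≡-1 = IsNat-unit (nm-IsNat a a-int) (nm-IsNat b b-int)
    (trans (sym (nm-· a b)) (trans (cong nm ab≡-1) nm-[-1K]))

  unit-inverse : ∀ {a b} → a · b ≡ -K 1K → nm a ≡ 1ℚ → b ≡ -K conj a
  unit-inverse {a} {b} ab≡-1 nm-a≡1 = begin
    b                 ≡⟨ ·-identityˡ b ⟨
    1K · b            ≡⟨ cong (_· b) (trans (·-conj a) (cong (_, 0ℚ) nm-a≡1)) ⟨
    (a · conj a) · b  ≡⟨ cong (_· b) (·-comm a (conj a)) ⟩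
    (conj a · a) · b  ≡⟨ ·-assoc (conj a) a b ⟩
    conj a · (a · b)  ≡⟨ cong (conj a ·_) ab≡-1 ⟩
    conj a · -K 1K    ≡⟨ x·-1≡-x (conj a) ⟩
    -K conj a         ∎
    where open ≡-Reasoning

  nm≡1-cases : ∀ p q → IsInt (tr (p , q)) → nm (p , q) ≡ 1ℚ →
               p ≡ 0ℚ ⊎ dℚ * ((q + q) * (q + q)) ≡ - fromℤ (+ 3) ⊎ q ≡ 0ℚ
  nm≡1-cases p q t-int nm≡1 = Sum.map p+p≡0⇒p≡0
    (Sum.map (disc≡t²-4 1ℚ) (p+p≡0⇒p≡0 ∘ dq²≡0⇒q≡0 (q + q) ∘ disc≡t²-4 (fromℤ (+ 4))))
    (IsInt-square≤4 t-int t²≤4)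
    where
    t = tr (p , q)
    disc = dℚ * ((q + q) * (q + q))
    t²≡4+disc : t * t ≡ fromℤ (+ 4) + disc
    t²≡4+disc = trans (tr²≡4nm+disc p q) (cong (λ m → fromℤ (+ 4) * m + disc) nm≡1)
    t²≤4 : t * t ≤ fromℤ (+ 4)
    t²≤4 = begin
      t * t                  ≡⟨ t²≡4+disc ⟩
      fromℤ (+ 4) + disc     ≤⟨ ℚ.+-monoʳ-≤ (fromℤ (+ 4)) (dq²≤0 (q + q)) ⟩
      fromℤ (+ 4) + 0ℚ       ≡⟨ ℚ.+-identityʳ _ ⟩
      fromℤ (+ 4)            ∎
      where open ℚ.≤-Reasoning
    disc≡t²-4 : ∀ s → t * t ≡ s → disc ≡ s - fromℤ (+ 4)
    disc≡t²-4 s t²≡s = begin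
      disc                                ≡⟨ solve 1 (λ x → x := con (fromℤ (+ 4)) :+ x :- con (fromℤ (+ 4))) refl disc ⟩
      fromℤ (+ 4) + disc - fromℤ (+ 4)    ≡⟨ cong (_- fromℤ (+ 4)) (trans (sym t²≡4+disc) t²≡s) ⟩
      s - fromℤ (+ 4)                     ∎
      where open ≡-Reasoning

  z²≡-1⇒-1∈dℚ² : ∀ {z} → z · z ≡ -K 1K → ∃[ v ] dℚ * (v * v) ≡ - 1ℚ
  z²≡-1⇒-1∈dℚ² {p , q} z²≡-1 = [ p≡0-case , q≡0-case ]′ (p*q≡0⇒p≡0∨q≡0 p q pq≡0)
    where
    open ≡-Reasoning
    re : p * p + dℚ * (q * q) ≡ - 1ℚ
    re = cong proj₁ z²≡-1
    pq≡0 : p * q ≡ 0ℚ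
    pq≡0 = p+p≡0⇒p≡0 (trans (cong (λ r → p * q + r) (ℚ.*-comm p q)) (cong proj₂ z²≡-1))
    p≡0-case : p ≡ 0ℚ → ∃[ v ] dℚ * (v * v) ≡ - 1ℚ
    p≡0-case p≡0 = q , (begin
      dℚ * (q * q)           ≡⟨ ℚ.+-identityˡ _ ⟨
      0ℚ + dℚ * (q * q)      ≡⟨ cong (λ p → p * p + dℚ * (q * q)) p≡0 ⟨
      p * p + dℚ * (q * q)   ≡⟨ re ⟩
      - 1ℚ                   ∎)
    q≡0⇒p²≡-1 : q ≡ 0ℚ → p * p ≡ - 1ℚ
    q≡0⇒p²≡-1 q≡0 = begin
      p * p                  ≡⟨ ℚ.+-identityʳ _ ⟨
      p * p + 0ℚ             ≡⟨ cong (λ r → p * p + r) (ℚ.*-zeroʳ dℚ) ⟨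
      p * p + dℚ * 0ℚ        ≡⟨ cong (λ q → p * p + dℚ * (q * q)) q≡0 ⟨
      p * p + dℚ * (q * q)   ≡⟨ re ⟩
      - 1ℚ                   ∎
    q≡0-case : q ≡ 0ℚ → ∃[ v ] dℚ * (v * v) ≡ - 1ℚ
    q≡0-case q≡0 with ℚ.*≤* () ← subst (0ℚ ≤_) (q≡0⇒p²≡-1 q≡0) (p*p≥0 p)

  a²≡1⇒¬triple : ∀ {a z c} → a · a ≡ 1K → z · z ≡ -K 1K → InOK c → c ≢ 0K → c ≢ a → c ≢ -K a →
                 IsSquareK (a · c ⊕ 1K) → IsSquareK (-K a · c ⊕ 1K) → ⊥
  a²≡1⇒¬triple {a} {z} {c} a²≡1 z²≡-1 c-int c≢0 c≢a c≢-a (x , ac+1≡x²) (y , -ac+1≡y²) =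
    c≢0 (w²≡z²+1⇒w≡0 c-int c²≡Z²+1 Z≢0)
    where
    open ≡-Reasoning
    Z = z · (x · y)
    c²≡Z²+1 : c · c ≡ Z · Z ⊕ 1K
    c²≡Z²+1 = begin
      c · c                                           ≡⟨ ·-identityˡ (c · c) ⟨
      1K · (c · c)                                    ≡⟨ cong (_· (c · c)) a²≡1 ⟨
      (a · a) · (c · c)                               ≡⟨ -[ac+1][-ac+1]+1≡a²c² a c ⟨
      -K 1K · ((a · c ⊕ 1K) · (-K a · c ⊕ 1K)) ⊕ 1K   ≡⟨ cong₂ (λ u v → -K 1K · (u · v) ⊕ 1K) ac+1≡x² -ac+1≡y² ⟩
      -K 1K · ((x · x) · (y · y)) ⊕ 1K                ≡⟨ cong (λ u → u · ((x · x) · (y · y)) ⊕ 1K) z²≡-1 ⟨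
      (z · z) · ((x · x) · (y · y)) ⊕ 1K              ≡⟨ cong (λ u → (z · z) · u ⊕ 1K) ([x·y]²≡x²·y² x y) ⟨
      (z · z) · ((x · y) · (x · y)) ⊕ 1K              ≡⟨ cong (_⊕ 1K) ([x·y]²≡x²·y² z (x · y)) ⟨
      Z · Z ⊕ 1K                                      ∎
    Z≢0 : Z ≢ 0K
    Z≢0 Z≡0 = [ c≢a , c≢-a ]′ (x²≡y²⇒x≡±y c a (begin
      c · c        ≡⟨ c²≡Z²+1 ⟩
      Z · Z ⊕ 1K   ≡⟨ cong (λ u → u · u ⊕ 1K) Z≡0 ⟩
      0K · 0K ⊕ 1K ≡⟨ cong (_⊕ 1K) (·-zeroʳ 0K) ⟩
      1K           ≡⟨ a²≡1 ⟨
      a · a        ∎))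

  ¬IsSquareK[a·b] : ∀ {a b c} → IsDiophantineTriple a b c → (a · b) · c ≢ 0K → ¬ IsSquareK (a · b)
  ¬IsSquareK[a·b] {a@(p , q)} {b} {c}
    (a-int , b-int , c-int , a≢b , a≢c , b≢c , ab+1-square , (x , _ , ac+1≡x²) , (y , _ , bc+1≡y²))
    abc≢0 ab-square@(z , ab≡z²) =
    [ p≢0 , [ disc≢-3 , q≢0 ]′ ]′ (nm≡1-cases p q (tr-IsInt a a-int) nm-a≡1)
    where
    ab≡-1 : a · b ≡ -K 1K
    ab≡-1 = square∧square+1⇒≡-1 ab-square ab+1-square (λ ab≡0 → abc≢0 (trans (cong (_· c) ab≡0) (·-zeroˡ c)))
    z²≡-1 : z · z ≡ -K 1K
    z²≡-1 = trans (sym ab≡z²) ab≡-1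
    nm-a≡1 : nm a ≡ 1ℚ
    nm-a≡1 = nm-unit {a} {b} a-int b-int ab≡-1
    b≡-ā : b ≡ -K conj a
    b≡-ā = unit-inverse ab≡-1 nm-a≡1

    p≢0 : p ≢ 0ℚ
    p≢0 p≡0 = a≢b (trans (cong₂ _,_ (trans p≡0 (cong -_ (sym p≡0))) (sym (⁻¹-involutive q))) (sym b≡-ā))

    disc≢-3 : dℚ * ((q + q) * (q + q)) ≢ - fromℤ (+ 3)
    disc≢-3 = let v , dv²≡-1 = z²≡-1⇒-1∈dℚ² {z} z²≡-1 in -1∈dℚ²⇒-3∉dℚ² dℚ (q + q) v dv²≡-1

    q≢0 : q ≢ 0ℚ
    q≢0 q≡0 = a²≡1⇒¬triple {a} {z} {c} a²≡1 z²≡-1 c-int c≢0 (a≢c ∘ sym) (b≢c ∘ trans b≡-a ∘ sym)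
      (x , ac+1≡x²) (y , subst (λ u → u · c ⊕ 1K ≡ y · y) b≡-a bc+1≡y²)
      where
      ā≡a : conj a ≡ a
      ā≡a = cong (p ,_) (trans (cong -_ q≡0) (sym q≡0))
      a²≡1 : a · a ≡ 1K
      a²≡1 = trans (cong (a ·_) (sym ā≡a)) (trans (·-conj a) (cong (_, 0ℚ) nm-a≡1))
      b≡-a : b ≡ -K a
      b≡-a = trans b≡-ā (cong -K_ ā≡a)
      c≢0 : c ≢ 0K
      c≢0 c≡0 = abc≢0 (trans (cong ((a · b) ·_) c≡0) (·-zeroʳ (a · b)))

  triple-swap : ∀ {a b c} → IsDiophantineTriple a b c → IsDiophantineTriple a c b
  triple-swap {a} {b} {c} (a-int , b-int , c-int , a≢b , a≢c , b≢c , ab+1 , ac+1 , bc+1) =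
    a-int , c-int , b-int , a≢c , a≢b , b≢c ∘ sym , ac+1 , ab+1 ,
    subst (λ u → IsSquareOK (u ⊕ 1K)) (·-comm b c) bc+1

  triple-rotate : ∀ {a b c} → IsDiophantineTriple a b c → IsDiophantineTriple b c a
  triple-rotate {a} {b} {c} (a-int , b-int , c-int , a≢b , a≢c , b≢c , ab+1 , ac+1 , bc+1) =
    b-int , c-int , a-int , b≢c , a≢b ∘ sym , a≢c ∘ sym , bc+1 ,
    subst (λ u → IsSquareOK (u ⊕ 1K)) (·-comm a b) ab+1 , subst (λ u → IsSquareOK (u ⊕ 1K)) (·-comm a c) ac+1

lemma1 : (D : ImagQuadParam) → (a b c : K) →
         Field.IsDiophantineTriple D a b c →
         Field._·_ D (Field._·_ D a b) c ≢ Field.0K D →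
         ¬ Field.IsSquareK D (Field._·_ D a b) ×
         ¬ Field.IsSquareK D (Field._·_ D a c) ×
         ¬ Field.IsSquareK D (Field._·_ D b c)
lemma1 D a b c triple abc≢0 =
    ¬IsSquareK[a·b] {a} {b} {c} triple abc≢0
  , ¬IsSquareK[a·b] {a} {c} {b} (triple-swap triple) (abc≢0 ∘ trans (sym acb≡abc))
  , ¬IsSquareK[a·b] {b} {c} {a} (triple-rotate triple) (abc≢0 ∘ trans (sym bca≡abc))
  where
  open Field D
  open ImaginaryQuadratic D
  acb≡abc : (a · c) · b ≡ (a · b) · c
  acb≡abc = trans (·-assoc a c b) (trans (cong (a ·_) (·-comm c b)) (sym (·-assoc a b c)))
  bca≡abc : (b · c) · a ≡ (a · b) · c
  bca≡abc = trans (·-comm (b · c) a) (sym (·-assoc a b c))
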